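{- For every $f\in\mathbb{F}_q[t]$ with $\deg f\ge1$ there exists a positive integer $n\le 1+\deg f$ such that $S^{(n)}(f)$ is a fixed point of $S$, i.e. $S(S^{(n)}(f))=S^{(n)}(f)$.
   Context: Let $\mathbb{F}_q$ be a finite field with $q$ elements ($q$ a prime power). Fix an enumeration $\mathbb{F}_q=\{a_0,a_1,\dots,a_{q-1}\}$ with $a_0=0$, $a_1=1$. Every nonzero $f\in\mathbb{F}_q[t]$ of degree $m$ is uniquely written $f=a_{i_0}+a_{i_1}t+\dots+a_{i_m}t^m$ with $0\le i_j\le q-1$, $a_{i_m}\neq 0$. Put $\delta(f)=i_0+i_1q+\dots+i_mq^m$ and $\delta(0)=0$. Order $\mathbb{F}_q[t]$ by: $f>g$ iff $\delta(f)>\delta(g)$. For nonzero $f$, $f!=\prod_{g<f}(f-g)$ (product over all $g\in\mathbb{F}_q[t]$ with $g<f$), and $0!=1$. For nonzero $f$, $S(f)$ is the smallest $g$ (in this order) with $f\mid g!$; $S(0)=0$. $S^{(n)}$ denotes the $n$-th iterate of $S$. -}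

module Defs where

open import Data.Nat as ℕ using (ℕ; zero; suc; _∸_; _≤_; _<_)
open import Data.Nat.DivMod using (_/_; _%_; m%n<n)
open import Data.Fin as Fin using (Fin; toℕ; fromℕ<)
open import Data.List using (List; []; _∷_; map; length)
open import Data.Product using (Σ; ∃; _×_; _,_)
open import Data.Sum using (_⊎_)
open import Relation.Binary.PropositionalEquality using (_≡_; _≢_)
open import Relation.Nullary using (¬_; yes; no)
open import Algebra.Structures using (IsCommutativeRing)

-- A finite field with q = 2 + r elements, together with an enumeration
-- F_q = {a_0, ..., a_{q-1}}, a_0 = 0, a_1 = 1, is (up to isomorphism) exactly a
-- field structure on Fin q whose zero is the index 0 and whose one is the index 1:
-- the element a_i is represented by its index i.
record FiniteField (r : ℕ) : Set where
  field
    _+F_ : Fin (suc (suc r)) → Fin (suc (suc r)) → Fin (suc (suc r))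
    _*F_ : Fin (suc (suc r)) → Fin (suc (suc r)) → Fin (suc (suc r))
    -F_  : Fin (suc (suc r)) → Fin (suc (suc r))
    isCommutativeRing : IsCommutativeRing _≡_ _+F_ _*F_ -F_ Fin.zero (Fin.suc Fin.zero)
    inverse : ∀ x → x ≢ Fin.zero → ∃ λ y → x *F y ≡ Fin.suc Fin.zero

module Poly {r : ℕ} (F : FiniteField r) where
  open FiniteField F

  q : ℕ
  q = suc (suc r)

  K : Set
  K = Fin q

  -- polynomials: coefficient lists, lowest degree first; trailing zeros allowed,
  -- polynomial equality is equality after stripping trailing zeros
  P : Set
  P = List K

  norm : P → P
  norm [] = []
  norm (c ∷ f) with norm f
  ... | [] with c Fin.≟ Fin.zero
  ...   | yes _ = []
  ...   | no _  = c ∷ []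
  norm (c ∷ f) | d ∷ g = c ∷ d ∷ g

  _≈P_ : P → P → Set
  f ≈P g = norm f ≡ norm g

  deg : P → ℕ
  deg f = length (norm f) ∸ 1

  addP : P → P → P
  addP [] g = g
  addP (c ∷ f) [] = c ∷ f
  addP (c ∷ f) (d ∷ g) = (c +F d) ∷ addP f g

  negP : P → P
  negP = map -F_

  subP : P → P → P
  subP f g = addP f (negP g)

  mulP : P → P → P
  mulP [] g = []
  mulP (c ∷ f) g = addP (map (c *F_) g) (Fin.zero ∷ mulP f g)

  oneP : P
  oneP = Fin.suc Fin.zero ∷ []

  δ : P → ℕ
  δ [] = 0
  δ (c ∷ f) = toℕ c ℕ.+ q ℕ.* δ f

  -- inverse of δ: base-q digits (fuel-bounded; fuel n suffices for n)
  digits : ℕ → ℕ → P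
  digits zero _ = []
  digits (suc fuel) zero = []
  digits (suc fuel) (suc n) = fromℕ< (m%n<n (suc n) q) ∷ digits fuel (suc n / q)

  decode : ℕ → P
  decode n = digits n n

  prodBelow : P → ℕ → P
  prodBelow f zero = oneP
  prodBelow f (suc k) = mulP (prodBelow f k) (subP f (decode k))

  -- f! = ∏_{g < f} (f - g);  for f = 0 this is the empty product 1
  _! : P → P
  f ! = prodBelow f (δ f)

  _∣P_ : P → P → Set
  f ∣P h = ∃ λ k → mulP k f ≈P h

  IsS : P → P → Set
  IsS f g = (δ f ≡ 0 × δ g ≡ 0)
          ⊎ (δ f ≢ 0 × f ∣P (g !) × (∀ h → δ h < δ g → ¬ (f ∣P (h !))))

  data IterS (f : P) : ℕ → P → Set where
    iter-zero : IterS f zero f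
    iter-suc  : ∀ {n g h} → IterS f n g → IsS g h → IterS f (suc n) h

{-# OPTIONS --safe #-}
-- Write δ g for the index of g in the enumeration, so q ^ d ≤ δ g < q ^ (d + 1) when deg g = d.
-- A nonzero image g = S(f) has constant term 0: for h = c + t·k, the factors h − (a + t·j) of h!
-- with δ j < δ k come in full blocks over a ∈ F_q, whose product does not depend on c, and the
-- remaining factors are nonzero constants; so (c + t·k)! divides (t·k)!, a smaller candidate.
-- Hence g = t·u. If deg u = 0 then g ∣ t!, so S(g) = t, a fixed point. If deg u = d ≥ 1 and
-- g ≠ t², then g already divides h! for some h of degree d (h = t^d, or h = c·t when u = c·t),
-- so deg S(g) < deg g; and for g = t² either deg S(g) < 2 or S(g) = g. Thus S lowers the degree
-- until it reaches a fixed point, and since deg S(f) ≤ deg f this takes at most 1 + deg f steps.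
module Submission where

open import Defs
open import Data.Nat using (ℕ; _≤_; _+_)
open import Data.Product using (∃; _×_)

open import Level using (0ℓ)
open import Function using (_∘_)
open import Data.Empty using (⊥-elim)
open import Data.Sum using (_⊎_; inj₁; inj₂; [_,_]′)
open import Data.Product using (_,_; proj₁; proj₂)
open import Data.Nat using (zero; suc; _<_; _*_; _^_; z≤n; s≤s; NonZero)
import Data.Nat.Properties as ℕₚ
open import Data.Nat.DivMod using (_/_; _%_; m%n<n; [m+kn]%n≡m%n; m<n⇒m%n≡m; m≡m%n+[m/n]*n; m/n<m)
open import Data.Fin as Fin using (Fin; toℕ; fromℕ<)
import Data.Fin.Properties as Finₚ
open import Data.Fin.Permutation using (permutation)
open import Data.List using (List; []; _∷_; map; length)
open import Data.Vec.Functional using (init)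
open import Algebra.Bundles using (CommutativeRing)
import Algebra.Properties.CommutativeMonoid.Sum as CommutativeMonoidSum
import Algebra.Properties.CommutativeSemigroup as CommutativeSemigroupProperties
import Algebra.Properties.Group as GroupProperties
open import Relation.Nullary using (¬_; Dec; yes; no)
open import Relation.Binary.Bundles using (Setoid)
open import Relation.Binary.Structures using (IsEquivalence)
open import Relation.Binary.PropositionalEquality
  using (_≡_; _≢_; refl; sym; trans; cong; cong₂; subst; subst₂; module ≡-Reasoning)
import Relation.Binary.Reasoning.Setoid as SetoidReasoning

Least : (ℕ → Set) → ℕ → Set
Least Q n = Q n × (∀ m → m < n → ¬ Q m)

least-or-none-below : ∀ {Q : ℕ → Set} → (∀ n → Dec (Q n)) → ∀ M → ∃ (Least Q) ⊎ (∀ m → m < M → ¬ Q m)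
least-or-none-below Q? zero = inj₂ λ _ ()
least-or-none-below Q? (suc M) with least-or-none-below Q? M
... | inj₁ found = inj₁ found
... | inj₂ none with Q? M
...   | yes QM  = inj₁ (M , QM , none)
...   | no  ¬QM = inj₂ λ m m<1+M → [ none m , (λ { refl → ¬QM }) ]′ (ℕₚ.m<1+n⇒m<n∨m≡n m<1+M)

least : ∀ {Q : ℕ → Set} → (∀ n → Dec (Q n)) → ∀ {N} → Q N → ∃ (Least Q)
least Q? {N} QN with least-or-none-below Q? (suc N)
... | inj₁ found = found
... | inj₂ none  = ⊥-elim (none N ℕₚ.≤-refl QN)

digits-injective : ∀ {m} .{{_ : NonZero m}} {a b x y} → a < m → b < m →
                   a + m * x ≡ b + m * y → a ≡ b × x ≡ y
digits-injective {m} {a} {b} {x} {y} a<m b<m eq =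
  a≡b , ℕₚ.*-cancelˡ-≡ x y m (ℕₚ.+-cancelˡ-≡ a _ _ (trans eq (cong (_+ m * y) (sym a≡b))))
  where
  lowDigit : ∀ {z} w → z < m → (z + m * w) % m ≡ z
  lowDigit {z} w z<m = trans (cong (λ n → (z + n) % m) (ℕₚ.*-comm m w))
                             (trans ([m+kn]%n≡m%n z w m) (m<n⇒m%n≡m z<m))
  a≡b : a ≡ b
  a≡b = trans (sym (lowDigit x a<m)) (trans (cong (_% m) eq) (lowDigit y b<m))

module _ {r : ℕ} (F : FiniteField r) where
  open FiniteField F
  open Poly F

  coefficientRing : CommutativeRing 0ℓ 0ℓ
  coefficientRing = record { isCommutativeRing = isCommutativeRing }

  private
    module 𝔽 = CommutativeRing coefficientRing
    module 𝔽+ = GroupProperties 𝔽.+-group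
  open 𝔽 using (0#; 1#)

  x*y≡0⇒y≡0 : ∀ {x y} → x ≢ 0# → x *F y ≡ 0# → y ≡ 0#
  x*y≡0⇒y≡0 {x} {y} x≢0 xy≡0 with inverse x x≢0
  ... | x⁻¹ , xx⁻¹≡1 = begin
    y                 ≡⟨ 𝔽.*-identityˡ y ⟨
    1# *F y           ≡⟨ cong (_*F y) (trans (sym xx⁻¹≡1) (𝔽.*-comm x x⁻¹)) ⟩
    (x⁻¹ *F x) *F y   ≡⟨ 𝔽.*-assoc x⁻¹ x y ⟩
    x⁻¹ *F (x *F y)   ≡⟨ cong (x⁻¹ *F_) xy≡0 ⟩
    x⁻¹ *F 0#         ≡⟨ 𝔽.zeroʳ x⁻¹ ⟩
    0#                ∎
    where open ≡-Reasoning

  x*y≢0 : ∀ {x y} → x ≢ 0# → y ≢ 0# → x *F y ≢ 0#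
  x*y≢0 x≢0 y≢0 xy≡0 = y≢0 (x*y≡0⇒y≡0 x≢0 xy≡0)

  x-y≢0 : ∀ {x y} → x ≢ y → x +F (-F y) ≢ 0#
  x-y≢0 {x} {y} x≢y x-y≡0 = x≢y (𝔽+.x∙y⁻¹≈ε⇒x≈y x y x-y≡0)

  x-[y+x]≡-y : ∀ x y → x +F (-F (y +F x)) ≡ -F y
  x-[y+x]≡-y x y = begin
    x +F (-F (y +F x))       ≡⟨ cong (x +F_) (𝔽+.⁻¹-anti-homo-∙ y x) ⟩
    x +F ((-F x) +F (-F y))  ≡⟨ 𝔽.+-assoc x (-F x) (-F y) ⟨
    (x +F (-F x)) +F (-F y)  ≡⟨ cong (_+F (-F y)) (𝔽.-‿inverseʳ x) ⟩
    0# +F (-F y)             ≡⟨ 𝔽.+-identityˡ (-F y) ⟩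
    -F y                     ∎
    where open ≡-Reasoning

  x-[x-y]≡y : ∀ x y → x +F (-F (x +F (-F y))) ≡ y
  x-[x-y]≡y x y = begin
    x +F (-F (x +F (-F y)))   ≡⟨ cong (λ a → x +F (-F a)) (𝔽.+-comm x (-F y)) ⟩
    x +F (-F ((-F y) +F x))   ≡⟨ x-[y+x]≡-y x (-F y) ⟩
    -F (-F y)                 ≡⟨ 𝔽+.⁻¹-involutive y ⟩
    y                         ∎
    where open ≡-Reasoning

  2≤toℕ : ∀ {c} → c ≢ 0# → c ≢ 1# → 2 ≤ toℕ c
  2≤toℕ {Fin.zero}               c≢0 _   = ⊥-elim (c≢0 refl)
  2≤toℕ {Fin.suc Fin.zero}       _   c≢1 = ⊥-elim (c≢1 refl)
  2≤toℕ {Fin.suc (Fin.suc _)}    _   _   = s≤s (s≤s z≤n)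

  -- Polynomials up to trailing zeros

  coeff : P → ℕ → K
  coeff []      _       = 0#
  coeff (c ∷ f) zero    = c
  coeff (c ∷ f) (suc n) = coeff f n

  infix 4 _≋_
  record _≋_ (f g : P) : Set where
    constructor mk≋
    field coeff-≡ : ∀ n → coeff f n ≡ coeff g n
  open _≋_

  ≋-isEquivalence : IsEquivalence _≋_
  ≋-isEquivalence = record
    { refl  = mk≋ λ _ → refl
    ; sym   = λ f≋g → mk≋ λ n → sym (coeff-≡ f≋g n)
    ; trans = λ f≋g g≋h → mk≋ λ n → trans (coeff-≡ f≋g n) (coeff-≡ g≋h n)
    }

  ≋-setoid : Setoid 0ℓ 0ℓ
  ≋-setoid = record { isEquivalence = ≋-isEquivalence }

  open Setoid ≋-setoid using ()
    renaming (refl to ≋-refl; sym to ≋-sym; trans to ≋-trans; reflexive to ≡⇒≋)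

  module ≋-Reasoning = SetoidReasoning ≋-setoid

  ∷-cong : ∀ {c d f g} → c ≡ d → f ≋ g → c ∷ f ≋ d ∷ g
  ∷-cong c≡d f≋g = mk≋ λ { zero → c≡d ; (suc n) → coeff-≡ f≋g n }

  ∷-injective : ∀ {c d f g} → c ∷ f ≋ d ∷ g → c ≡ d × f ≋ g
  ∷-injective p = coeff-≡ p 0 , mk≋ λ n → coeff-≡ p (suc n)

  ∷≋[]⁻¹ : ∀ {c f} → c ∷ f ≋ [] → c ≡ 0# × f ≋ []
  ∷≋[]⁻¹ p = coeff-≡ p 0 , mk≋ λ n → coeff-≡ p (suc n)

  0∷≋[] : ∀ {f} → f ≋ [] → 0# ∷ f ≋ []
  0∷≋[] f≋[] = mk≋ λ { zero → refl ; (suc n) → coeff-≡ f≋[] n }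

  normCons : K → P → P
  normCons c [] with c Fin.≟ 0#
  ... | yes _ = []
  ... | no _  = c ∷ []
  normCons c (d ∷ g) = c ∷ d ∷ g

  norm-∷ : ∀ c f → norm (c ∷ f) ≡ normCons c (norm f)
  norm-∷ c f with norm f
  ... | [] with c Fin.≟ 0#
  ...   | yes _ = refl
  ...   | no _  = refl
  norm-∷ c f | _ ∷ _ = refl

  normCons-≋ : ∀ c f → normCons c f ≋ c ∷ f
  normCons-≋ c [] with c Fin.≟ 0#
  ... | yes c≡0 = ≋-sym (≋-trans (∷-cong c≡0 ≋-refl) (0∷≋[] ≋-refl))
  ... | no _    = ≋-refl
  normCons-≋ c (d ∷ g) = ≋-refl

  norm-≋ : ∀ f → norm f ≋ f
  norm-≋ []      = ≋-refl
  norm-≋ (c ∷ f) rewrite norm-∷ c f = ≋-trans (normCons-≋ c (norm f)) (∷-cong refl (norm-≋ f))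

  ≋⇒≈P : ∀ {f g} → f ≋ g → f ≈P g
  ≋⇒≈P {[]}    {[]}    _ = refl
  ≋⇒≈P {[]}    {d ∷ g} p with ∷≋[]⁻¹ (≋-sym p)
  ... | refl , g≋[] rewrite norm-∷ 0# g | ≋⇒≈P g≋[] = refl
  ≋⇒≈P {c ∷ f} {[]}    p with ∷≋[]⁻¹ p
  ... | refl , f≋[] rewrite norm-∷ 0# f | ≋⇒≈P f≋[] = refl
  ≋⇒≈P {c ∷ f} {d ∷ g} p with ∷-injective p
  ... | refl , f≋g rewrite norm-∷ c f | norm-∷ c g | ≋⇒≈P f≋g = refl

  ≈P⇒≋ : ∀ {f g} → f ≈P g → f ≋ g
  ≈P⇒≋ {f} {g} nf≡ng =
    ≋-trans (≋-sym (norm-≋ f)) (≋-trans (mk≋ λ n → cong (λ h → coeff h n) nf≡ng) (norm-≋ g))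

  -- The ring of polynomials

  scale : K → P → P
  scale c = map (c *F_)

  coeff-addP : ∀ f g n → coeff (addP f g) n ≡ coeff f n +F coeff g n
  coeff-addP []      g       n       = sym (𝔽.+-identityˡ _)
  coeff-addP (c ∷ f) []      n       = sym (𝔽.+-identityʳ _)
  coeff-addP (c ∷ f) (d ∷ g) zero    = refl
  coeff-addP (c ∷ f) (d ∷ g) (suc n) = coeff-addP f g n

  coeff-negP : ∀ f n → coeff (negP f) n ≡ -F coeff f n
  coeff-negP []      n       = sym 𝔽+.ε⁻¹≈ε
  coeff-negP (c ∷ f) zero    = refl
  coeff-negP (c ∷ f) (suc n) = coeff-negP f n

  coeff-subP : ∀ f g n → coeff (subP f g) n ≡ coeff f n +F (-F coeff g n)
  coeff-subP f g n = trans (coeff-addP f (negP g) n) (cong (coeff f n +F_) (coeff-negP g n))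

  coeff-scale : ∀ c f n → coeff (scale c f) n ≡ c *F coeff f n
  coeff-scale c []      n       = sym (𝔽.zeroʳ c)
  coeff-scale c (d ∷ f) zero    = refl
  coeff-scale c (d ∷ f) (suc n) = coeff-scale c f n

  addP-cong : ∀ {f f′ g g′} → f ≋ f′ → g ≋ g′ → addP f g ≋ addP f′ g′
  addP-cong {f} {f′} {g} {g′} f≋f′ g≋g′ = mk≋ λ n → trans (coeff-addP f g n)
    (trans (cong₂ _+F_ (coeff-≡ f≋f′ n) (coeff-≡ g≋g′ n)) (sym (coeff-addP f′ g′ n)))

  addP-comm : ∀ f g → addP f g ≋ addP g f
  addP-comm f g = mk≋ λ n → trans (coeff-addP f g n) (trans (𝔽.+-comm _ _) (sym (coeff-addP g f n)))

  addP-assoc : ∀ f g h → addP (addP f g) h ≋ addP f (addP g h)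
  addP-assoc f g h = mk≋ λ n → begin
    coeff (addP (addP f g) h) n               ≡⟨ coeff-addP (addP f g) h n ⟩
    coeff (addP f g) n +F coeff h n           ≡⟨ cong (_+F coeff h n) (coeff-addP f g n) ⟩
    (coeff f n +F coeff g n) +F coeff h n     ≡⟨ 𝔽.+-assoc _ _ _ ⟩
    coeff f n +F (coeff g n +F coeff h n)     ≡⟨ cong (coeff f n +F_) (coeff-addP g h n) ⟨
    coeff f n +F coeff (addP g h) n           ≡⟨ coeff-addP f (addP g h) n ⟨
    coeff (addP f (addP g h)) n               ∎
    where open ≡-Reasoning

  addP-interchange : ∀ f g h k → addP (addP f g) (addP h k) ≋ addP (addP f h) (addP g k)
  addP-interchange f g h k = mk≋ λ n → begin
    coeff (addP (addP f g) (addP h k)) n                        ≡⟨ lhs n ⟩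
    (coeff f n +F coeff g n) +F (coeff h n +F coeff k n)        ≡⟨ 𝔽+ᶜ.interchange _ _ _ _ ⟩
    (coeff f n +F coeff h n) +F (coeff g n +F coeff k n)        ≡⟨ rhs n ⟨
    coeff (addP (addP f h) (addP g k)) n                        ∎
    where
    open ≡-Reasoning
    module 𝔽+ᶜ = CommutativeSemigroupProperties 𝔽.+-commutativeSemigroup
    expand : ∀ a b c d n → coeff (addP (addP a b) (addP c d)) n
                         ≡ (coeff a n +F coeff b n) +F (coeff c n +F coeff d n)
    expand a b c d n = trans (coeff-addP (addP a b) (addP c d) n)
                             (cong₂ _+F_ (coeff-addP a b n) (coeff-addP c d n))
    lhs = expand f g h k
    rhs = expand f h g k

  addP-identityʳ : ∀ f → addP f [] ≋ f
  addP-identityʳ []      = ≋-refl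
  addP-identityʳ (c ∷ f) = ≋-refl

  addP-inverseʳ : ∀ f → addP f (negP f) ≋ []
  addP-inverseʳ f = mk≋ λ n → trans (coeff-subP f f n) (𝔽.-‿inverseʳ _)

  negP-cong : ∀ {f g} → f ≋ g → negP f ≋ negP g
  negP-cong {f} {g} f≋g = mk≋ λ n →
    trans (coeff-negP f n) (trans (cong -F_ (coeff-≡ f≋g n)) (sym (coeff-negP g n)))

  scale-cong : ∀ c {f g} → f ≋ g → scale c f ≋ scale c g
  scale-cong c {f} {g} f≋g = mk≋ λ n →
    trans (coeff-scale c f n) (trans (cong (c *F_) (coeff-≡ f≋g n)) (sym (coeff-scale c g n)))

  scale-distribˡ : ∀ c f g → scale c (addP f g) ≋ addP (scale c f) (scale c g)
  scale-distribˡ c f g = mk≋ λ n → begin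
    coeff (scale c (addP f g)) n                       ≡⟨ coeff-scale c (addP f g) n ⟩
    c *F coeff (addP f g) n                            ≡⟨ cong (c *F_) (coeff-addP f g n) ⟩
    c *F (coeff f n +F coeff g n)                      ≡⟨ 𝔽.distribˡ c _ _ ⟩
    (c *F coeff f n) +F (c *F coeff g n)               ≡⟨ cong₂ _+F_ (coeff-scale c f n) (coeff-scale c g n) ⟨
    coeff (scale c f) n +F coeff (scale c g) n         ≡⟨ coeff-addP (scale c f) (scale c g) n ⟨
    coeff (addP (scale c f) (scale c g)) n             ∎
    where open ≡-Reasoning

  scale-distribʳ : ∀ c d f → scale (c +F d) f ≋ addP (scale c f) (scale d f)
  scale-distribʳ c d f = mk≋ λ n → begin
    coeff (scale (c +F d) f) n                         ≡⟨ coeff-scale (c +F d) f n ⟩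
    (c +F d) *F coeff f n                              ≡⟨ 𝔽.distribʳ _ c d ⟩
    (c *F coeff f n) +F (d *F coeff f n)               ≡⟨ cong₂ _+F_ (coeff-scale c f n) (coeff-scale d f n) ⟨
    coeff (scale c f) n +F coeff (scale d f) n         ≡⟨ coeff-addP (scale c f) (scale d f) n ⟨
    coeff (addP (scale c f) (scale d f)) n             ∎
    where open ≡-Reasoning

  scale-zero : ∀ f → scale 0# f ≋ []
  scale-zero f = mk≋ λ n → trans (coeff-scale 0# f n) (𝔽.zeroˡ _)

  scale-one : ∀ f → scale 1# f ≋ f
  scale-one f = mk≋ λ n → trans (coeff-scale 1# f n) (𝔽.*-identityˡ _)

  scale-scale : ∀ c d f → scale c (scale d f) ≋ scale (c *F d) f
  scale-scale c d f = mk≋ λ n → trans (coeff-scale c (scale d f) n)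
    (trans (cong (c *F_) (coeff-scale d f n))
           (trans (sym (𝔽.*-assoc c d _)) (sym (coeff-scale (c *F d) f n))))

  addP-swap : ∀ f g h → addP f (addP g h) ≋ addP g (addP f h)
  addP-swap f g h =
    ≋-trans (≋-sym (addP-assoc f g h)) (≋-trans (addP-cong (addP-comm f g) ≋-refl) (addP-assoc g f h))

  mulP-zeroʳ : ∀ f → mulP f [] ≋ []
  mulP-zeroʳ []      = ≋-refl
  mulP-zeroʳ (c ∷ f) = 0∷≋[] (mulP-zeroʳ f)

  mulP-0∷ : ∀ f g → mulP (0# ∷ f) g ≋ 0# ∷ mulP f g
  mulP-0∷ f g = addP-cong (scale-zero g) ≋-refl

  mulP-≋[]ˡ : ∀ {f} g → f ≋ [] → mulP f g ≋ []
  mulP-≋[]ˡ {[]}    g _ = ≋-refl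
  mulP-≋[]ˡ {c ∷ f} g p with ∷≋[]⁻¹ p
  ... | refl , f≋[] = ≋-trans (mulP-0∷ f g) (0∷≋[] (mulP-≋[]ˡ g f≋[]))

  mulP-congˡ : ∀ {f f′} g → f ≋ f′ → mulP f g ≋ mulP f′ g
  mulP-congˡ {[]}    {f′}     g p = ≋-sym (mulP-≋[]ˡ g (≋-sym p))
  mulP-congˡ {c ∷ f} {[]}     g p = mulP-≋[]ˡ g p
  mulP-congˡ {c ∷ f} {d ∷ f′} g p with ∷-injective p
  ... | refl , f≋f′ = addP-cong ≋-refl (∷-cong refl (mulP-congˡ g f≋f′))

  mulP-congʳ : ∀ f {g g′} → g ≋ g′ → mulP f g ≋ mulP f g′
  mulP-congʳ []      g≋g′ = ≋-refl
  mulP-congʳ (c ∷ f) g≋g′ = addP-cong (scale-cong c g≋g′) (∷-cong refl (mulP-congʳ f g≋g′))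

  mulP-∷ʳ : ∀ f d g → mulP f (d ∷ g) ≋ addP (scale d f) (0# ∷ mulP f g)
  mulP-∷ʳ []      d g = ≋-sym (0∷≋[] ≋-refl)
  mulP-∷ʳ (c ∷ f) d g = ∷-cong (cong (_+F 0#) (𝔽.*-comm c d)) (begin
    addP (scale c g) (mulP f (d ∷ g))                          ≈⟨ addP-cong ≋-refl (mulP-∷ʳ f d g) ⟩
    addP (scale c g) (addP (scale d f) (0# ∷ mulP f g))        ≈⟨ addP-swap (scale c g) (scale d f) _ ⟩
    addP (scale d f) (addP (scale c g) (0# ∷ mulP f g))        ∎)
    where open ≋-Reasoning

  mulP-comm : ∀ f g → mulP f g ≋ mulP g f
  mulP-comm []      g = ≋-sym (mulP-zeroʳ g)
  mulP-comm (c ∷ f) g = ≋-trans (addP-cong ≋-refl (∷-cong refl (mulP-comm f g))) (≋-sym (mulP-∷ʳ g c f))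

  mulP-scaleˡ : ∀ c f g → mulP (scale c f) g ≋ scale c (mulP f g)
  mulP-scaleˡ c []      g = ≋-refl
  mulP-scaleˡ c (d ∷ f) g = begin
    addP (scale (c *F d) g) (0# ∷ mulP (scale c f) g)
      ≈⟨ addP-cong (≋-sym (scale-scale c d g)) (∷-cong (sym (𝔽.zeroʳ c)) (mulP-scaleˡ c f g)) ⟩
    addP (scale c (scale d g)) (scale c (0# ∷ mulP f g))
      ≈⟨ scale-distribˡ c (scale d g) (0# ∷ mulP f g) ⟨
    scale c (addP (scale d g) (0# ∷ mulP f g))                 ∎
    where open ≋-Reasoning

  mulP-distribʳ : ∀ f f′ g → mulP (addP f f′) g ≋ addP (mulP f g) (mulP f′ g)
  mulP-distribʳ []      f′       g = ≋-refl
  mulP-distribʳ (c ∷ f) []       g = ≋-sym (addP-identityʳ _)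
  mulP-distribʳ (c ∷ f) (c′ ∷ f′) g = begin
    addP (scale (c +F c′) g) (0# ∷ mulP (addP f f′) g)
      ≈⟨ addP-cong (scale-distribʳ c c′ g) (∷-cong (sym (𝔽.+-identityʳ 0#)) (mulP-distribʳ f f′ g)) ⟩
    addP (addP (scale c g) (scale c′ g)) (addP (0# ∷ mulP f g) (0# ∷ mulP f′ g))
      ≈⟨ addP-interchange (scale c g) (scale c′ g) _ _ ⟩
    addP (mulP (c ∷ f) g) (mulP (c′ ∷ f′) g)
      ∎
    where open ≋-Reasoning

  mulP-distribˡ : ∀ f g h → mulP f (addP g h) ≋ addP (mulP f g) (mulP f h)
  mulP-distribˡ f g h = ≋-trans (mulP-comm f (addP g h))
    (≋-trans (mulP-distribʳ g h f) (addP-cong (mulP-comm g f) (mulP-comm h f)))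

  mulP-assoc : ∀ f g h → mulP (mulP f g) h ≋ mulP f (mulP g h)
  mulP-assoc []      g h = ≋-refl
  mulP-assoc (c ∷ f) g h = begin
    mulP (addP (scale c g) (0# ∷ mulP f g)) h
      ≈⟨ mulP-distribʳ (scale c g) (0# ∷ mulP f g) h ⟩
    addP (mulP (scale c g) h) (mulP (0# ∷ mulP f g) h)
      ≈⟨ addP-cong (mulP-scaleˡ c g h) (mulP-0∷ (mulP f g) h) ⟩
    addP (scale c (mulP g h)) (0# ∷ mulP (mulP f g) h)
      ≈⟨ addP-cong ≋-refl (∷-cong refl (mulP-assoc f g h)) ⟩
    addP (scale c (mulP g h)) (0# ∷ mulP f (mulP g h))
      ∎
    where open ≋-Reasoning

  mulP-identityˡ : ∀ f → mulP oneP f ≋ f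
  mulP-identityˡ f = ≋-trans (addP-cong (scale-one f) (0∷≋[] ≋-refl)) (addP-identityʳ f)

  polynomialRing : CommutativeRing 0ℓ 0ℓ
  polynomialRing = record
    { Carrier = P ; _≈_ = _≋_ ; _+_ = addP ; _*_ = mulP ; -_ = negP ; 0# = [] ; 1# = oneP
    ; isCommutativeRing = record
      { isRing = record
        { +-isAbelianGroup = record
          { isGroup = record
            { isMonoid = record
              { isSemigroup = record
                { isMagma = record { isEquivalence = ≋-isEquivalence ; ∙-cong = addP-cong }
                ; assoc = addP-assoc }
              ; identity = (λ _ → ≋-refl) , addP-identityʳ }
            ; inverse = (λ f → ≋-trans (addP-comm (negP f) f) (addP-inverseʳ f)) , addP-inverseʳ
            ; ⁻¹-cong = negP-cong }
          ; comm = addP-comm }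
        ; *-cong = λ {f} {f′} {g} f≋f′ g≋g′ → ≋-trans (mulP-congˡ g f≋f′) (mulP-congʳ f′ g≋g′)
        ; *-assoc = mulP-assoc
        ; *-identity = mulP-identityˡ , (λ f → ≋-trans (mulP-comm f oneP) (mulP-identityˡ f))
        ; distrib = mulP-distribˡ , (λ f g h → mulP-distribʳ g h f) }
      ; *-comm = mulP-comm } }

  private
    module ℙ = CommutativeRing polynomialRing
    module ℙΣ = CommutativeMonoidSum ℙ.*-commutativeMonoid

  subP-subP : ∀ f g → subP f (subP f g) ≋ g
  subP-subP f g = mk≋ λ n → trans (coeff-subP f (subP f g) n)
    (trans (cong (λ a → coeff f n +F (-F a)) (coeff-subP f g n)) (x-[x-y]≡y _ _))

  mulP-0∷ʳ : ∀ f g → mulP f (0# ∷ g) ≋ 0# ∷ mulP f g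
  mulP-0∷ʳ f g = ≋-trans (mulP-∷ʳ f 0# g) (addP-cong (scale-zero f) ≋-refl)

  mulP-constˡ : ∀ c g → mulP (c ∷ []) g ≋ scale c g
  mulP-constˡ c g = ≋-trans (addP-cong ≋-refl (0∷≋[] ≋-refl)) (addP-identityʳ (scale c g))

  -- The enumeration δ

  q≢0 : q ≢ 0
  q≢0 ()

  1<q : 1 < q
  1<q = s≤s (s≤s z≤n)

  q^1≡q : q ^ 1 ≡ q
  q^1≡q = ℕₚ.*-identityʳ q

  δ-≋[] : ∀ {f} → f ≋ [] → δ f ≡ 0
  δ-≋[] {[]}    _ = refl
  δ-≋[] {c ∷ f} p with ∷≋[]⁻¹ p
  ... | refl , f≋[] rewrite δ-≋[] f≋[] = ℕₚ.*-zeroʳ q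

  δ-cong : ∀ {f g} → f ≋ g → δ f ≡ δ g
  δ-cong {[]}    {g}     p = sym (δ-≋[] (≋-sym p))
  δ-cong {c ∷ f} {[]}    p = δ-≋[] p
  δ-cong {c ∷ f} {d ∷ g} p with ∷-injective p
  ... | refl , f≋g = cong (λ n → toℕ c + q * n) (δ-cong f≋g)

  δ≡0⇒≋[] : ∀ f → δ f ≡ 0 → f ≋ []
  δ≡0⇒≋[] []      _    = ≋-refl
  δ≡0⇒≋[] (c ∷ f) δ≡0 with ℕₚ.m*n≡0⇒m≡0∨n≡0 q (ℕₚ.m+n≡0⇒n≡0 (toℕ c) δ≡0)
  ... | inj₁ ()
  ... | inj₂ δf≡0 =
    ≋-trans (∷-cong (Finₚ.toℕ-injective (ℕₚ.m+n≡0⇒m≡0 (toℕ c) δ≡0)) (δ≡0⇒≋[] f δf≡0)) (0∷≋[] ≋-refl)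

  δ-injective : ∀ f g → δ f ≡ δ g → f ≋ g
  δ-injective []      g       eq = ≋-sym (δ≡0⇒≋[] g (sym eq))
  δ-injective (c ∷ f) []      eq = δ≡0⇒≋[] (c ∷ f) eq
  δ-injective (c ∷ f) (d ∷ g) eq with digits-injective (Finₚ.toℕ<n c) (Finₚ.toℕ<n d) eq
  ... | c≡d , δf≡δg = ∷-cong (Finₚ.toℕ-injective c≡d) (δ-injective f g δf≡δg)

  δ-digits : ∀ fuel n → n ≤ fuel → δ (digits fuel n) ≡ n
  δ-digits zero       zero    _         = refl
  δ-digits (suc fuel) zero    _         = refl
  δ-digits (suc fuel) (suc n) (s≤s n≤fuel) = begin
    toℕ (fromℕ< (m%n<n (suc n) q)) + q * δ (digits fuel (suc n / q))
      ≡⟨ cong₂ _+_ (Finₚ.toℕ-fromℕ< (m%n<n (suc n) q))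
                   (cong (q *_) (δ-digits fuel (suc n / q) quotient≤fuel)) ⟩
    suc n % q + q * (suc n / q)                         ≡⟨ cong (suc n % q +_) (ℕₚ.*-comm q (suc n / q)) ⟩
    suc n % q + suc n / q * q                           ≡⟨ m≡m%n+[m/n]*n (suc n) q ⟨
    suc n                                               ∎
    where
    open ≡-Reasoning
    quotient≤fuel : suc n / q ≤ fuel
    quotient≤fuel = ℕₚ.≤-trans (ℕₚ.<⇒≤pred (m/n<m (suc n) q 1<q)) n≤fuel

  δ-decode : ∀ n → δ (decode n) ≡ n
  δ-decode n = δ-digits n n ℕₚ.≤-refl

  decode-δ : ∀ f → decode (δ f) ≋ f
  decode-δ f = δ-injective _ _ (δ-decode (δ f))

  _≋?_ : ∀ f g → Dec (f ≋ g)
  f ≋? g with δ f ℕₚ.≟ δ g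
  ... | yes δf≡δg = yes (δ-injective f g δf≡δg)
  ... | no  δf≢δg = no λ f≋g → δf≢δg (δ-cong f≋g)

  decode-digit : ∀ k {j} (j<q : j < q) → decode (q * k + j) ≋ fromℕ< j<q ∷ decode k
  decode-digit k {j} j<q = δ-injective _ _ (begin
    δ (decode (q * k + j))               ≡⟨ δ-decode (q * k + j) ⟩
    q * k + j                            ≡⟨ ℕₚ.+-comm (q * k) j ⟩
    j + q * k                            ≡⟨ cong₂ _+_ (Finₚ.toℕ-fromℕ< j<q) (cong (q *_) (δ-decode k)) ⟨
    toℕ (fromℕ< j<q) + q * δ (decode k)  ∎)
    where open ≡-Reasoning

  -- Degree

  infix 4 _deg<_
  record _deg<_ (f : P) (n : ℕ) : Set where
    constructor mk-deg<
    field vanish : ∀ i → n ≤ i → coeff f i ≡ 0#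
  open _deg<_

  HasDegree : P → ℕ → Set
  HasDegree f d = coeff f d ≢ 0# × f deg< suc d

  []-deg< : ∀ {n} → [] deg< n
  []-deg< = mk-deg< λ _ _ → refl

  deg<-resp-≋ : ∀ {f g n} → f ≋ g → f deg< n → g deg< n
  deg<-resp-≋ f≋g f<n = mk-deg< λ i n≤i → trans (sym (coeff-≡ f≋g i)) (vanish f<n i n≤i)

  deg<-mono : ∀ {f m n} → m ≤ n → f deg< m → f deg< n
  deg<-mono m≤n f<m = mk-deg< λ i n≤i → vanish f<m i (ℕₚ.≤-trans m≤n n≤i)

  deg<-length : ∀ f → f deg< length f
  deg<-length []      = []-deg<
  deg<-length (c ∷ f) = mk-deg< λ { (suc i) (s≤s n≤i) → vanish (deg<-length f) i n≤i }

  deg<0⇒≋[] : ∀ {f} → f deg< 0 → f ≋ []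
  deg<0⇒≋[] f<0 = mk≋ λ n → vanish f<0 n z≤n

  deg<-tail : ∀ {c f n} → c ∷ f deg< suc n → f deg< n
  deg<-tail cf<1+n = mk-deg< λ i n≤i → vanish cf<1+n (suc i) (s≤s n≤i)

  deg<-∷ : ∀ {c f n} → f deg< n → c ∷ f deg< suc n
  deg<-∷ f<n = mk-deg< λ { (suc i) (s≤s n≤i) → vanish f<n i n≤i }

  deg<⇒δ< : ∀ {f n} → f deg< n → δ f < q ^ n
  deg<⇒δ< {[]}    {n}     _      = ℕₚ.m^n>0 q n
  deg<⇒δ< {c ∷ f} {zero}  cf<0   = subst (_< 1) (sym (δ-≋[] (deg<0⇒≋[] cf<0))) (s≤s z≤n)
  deg<⇒δ< {c ∷ f} {suc n} cf<1+n = begin-strict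
    toℕ c + q * δ f     <⟨ ℕₚ.+-monoˡ-< (q * δ f) (Finₚ.toℕ<n c) ⟩
    q + q * δ f         ≡⟨ ℕₚ.*-suc q (δ f) ⟨
    q * suc (δ f)       ≤⟨ ℕₚ.*-monoʳ-≤ q (deg<⇒δ< (deg<-tail cf<1+n)) ⟩
    q * q ^ n           ∎
    where open ℕₚ.≤-Reasoning

  δ<⇒deg< : ∀ f n → δ f < q ^ n → f deg< n
  δ<⇒deg< []      n       _   = []-deg<
  δ<⇒deg< (c ∷ f) zero    δ<1 = mk-deg< λ i _ → coeff-≡ (δ≡0⇒≋[] (c ∷ f) (ℕₚ.n<1⇒n≡0 δ<1)) i
  δ<⇒deg< (c ∷ f) (suc n) δ<  = deg<-∷ (δ<⇒deg< f n (ℕₚ.*-cancelˡ-< q (δ f) (q ^ n)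
                                  (ℕₚ.≤-<-trans (ℕₚ.m≤n+m (q * δ f) (toℕ c)) δ<)))

  δ<q^[1+deg] : ∀ f → δ f < q ^ suc (deg f)
  δ<q^[1+deg] f = deg<⇒δ<
    (deg<-mono (ℕₚ.m≤n+m∸n (length (norm f)) 1) (deg<-resp-≋ (norm-≋ f) (deg<-length (norm f))))

  deg<-addP : ∀ {f g n} → f deg< n → g deg< n → addP f g deg< n
  deg<-addP {f} {g} f<n g<n = mk-deg< λ i n≤i →
    trans (coeff-addP f g i) (trans (cong₂ _+F_ (vanish f<n i n≤i) (vanish g<n i n≤i)) (𝔽.+-identityʳ 0#))

  deg<-scale : ∀ c {f n} → f deg< n → scale c f deg< n
  deg<-scale c {f} f<n = mk-deg< λ i n≤i →
    trans (coeff-scale c f i) (trans (cong (c *F_) (vanish f<n i n≤i)) (𝔽.zeroʳ c))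

  deg<-mulP : ∀ {f g} m n → f deg< m → g deg< suc n → mulP f g deg< m + n
  deg<-mulP {f}     {g} zero    n f<0 _ = deg<-resp-≋ (≋-sym (mulP-≋[]ˡ g (deg<0⇒≋[] f<0))) []-deg<
  deg<-mulP {[]}    {g} (suc m) n _   _ = []-deg<
  deg<-mulP {c ∷ f} {g} (suc m) n cf<1+m g<1+n =
    deg<-addP (deg<-scale c (deg<-mono (s≤s (ℕₚ.m≤n+m n m)) g<1+n))
              (deg<-∷ (deg<-mulP m n (deg<-tail cf<1+m) g<1+n))

  deg<-negP : ∀ {f n} → f deg< n → negP f deg< n
  deg<-negP {f} f<n = mk-deg< λ i n≤i →
    trans (coeff-negP f i) (trans (cong -F_ (vanish f<n i n≤i)) 𝔽+.ε⁻¹≈ε)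

  deg<-pred : ∀ {f n} → f deg< suc n → coeff f n ≡ 0# → f deg< n
  deg<-pred f<1+n fn≡0 = mk-deg< λ i n≤i →
    [ vanish f<1+n i , (λ { refl → fn≡0 }) ]′ (ℕₚ.m≤n⇒m<n∨m≡n n≤i)

  coeff-mulP-top : ∀ f g a b → f deg< suc a → g deg< suc b →
                   coeff (mulP f g) (a + b) ≡ coeff f a *F coeff g b
  coeff-mulP-top []      g a       b _ _ = sym (𝔽.zeroˡ _)
  coeff-mulP-top (c ∷ f) g zero    b cf<1 _ = begin
    coeff (mulP (c ∷ f) g) b    ≡⟨ coeff-≡ (mulP-congˡ g (∷-cong refl (deg<0⇒≋[] (deg<-tail cf<1)))) b ⟩
    coeff (mulP (c ∷ []) g) b   ≡⟨ coeff-≡ (mulP-constˡ c g) b ⟩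
    coeff (scale c g) b         ≡⟨ coeff-scale c g b ⟩
    c *F coeff g b              ∎
    where open ≡-Reasoning
  coeff-mulP-top (c ∷ f) g (suc a) b cf<2+a g<1+b = begin
    coeff (mulP (c ∷ f) g) (suc (a + b))
      ≡⟨ coeff-addP (scale c g) (0# ∷ mulP f g) (suc (a + b)) ⟩
    coeff (scale c g) (suc (a + b)) +F coeff (mulP f g) (a + b)
      ≡⟨ cong₂ _+F_ (vanish (deg<-scale c g<1+b) (suc (a + b)) (s≤s (ℕₚ.m≤n+m b a)))
                    (coeff-mulP-top f g a b (deg<-tail cf<2+a) g<1+b) ⟩
    0# +F (coeff f a *F coeff g b)                            ≡⟨ 𝔽.+-identityˡ _ ⟩
    coeff f a *F coeff g b                                    ∎
    where open ≡-Reasoning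

  HasDegree-mulP : ∀ {f g a b} → HasDegree f a → HasDegree g b → HasDegree (mulP f g) (a + b)
  HasDegree-mulP {f} {g} {a} {b} (fa≢0 , f<1+a) (gb≢0 , g<1+b) =
    (λ top≡0 → x*y≢0 fa≢0 gb≢0 (trans (sym (coeff-mulP-top f g a b f<1+a g<1+b)) top≡0)) ,
    deg<-mulP (suc a) b f<1+a g<1+b

  ≋[]⊎HasDegree : ∀ f → f ≋ [] ⊎ ∃ (HasDegree f)
  ≋[]⊎HasDegree []      = inj₁ ≋-refl
  ≋[]⊎HasDegree (c ∷ f) with ≋[]⊎HasDegree f
  ... | inj₂ (d , fd≢0 , f<1+d) = inj₂ (suc d , fd≢0 , deg<-∷ f<1+d)
  ... | inj₁ f≋[] with c Fin.≟ 0#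
  ...   | yes c≡0 = inj₁ (≋-trans (∷-cong c≡0 f≋[]) (0∷≋[] ≋-refl))
  ...   | no  c≢0 = inj₂ (0 , c≢0 , deg<-∷ (deg<-resp-≋ (≋-sym f≋[]) []-deg<))

  HasDegree⇒< : ∀ {f d n} → HasDegree f d → f deg< n → d < n
  HasDegree⇒< {d = d} {n} (fd≢0 , _) f<n with d ℕₚ.<? n
  ... | yes d<n = d<n
  ... | no  d≮n = ⊥-elim (fd≢0 (vanish f<n d (ℕₚ.≮⇒≥ d≮n)))

  deg<1-shape : ∀ {u} → u deg< 1 → u ≋ coeff u 0 ∷ []
  deg<1-shape u<1 = mk≋ λ { zero → refl ; (suc i) → vanish u<1 (suc i) (s≤s z≤n) }

  deg<2-shape : ∀ {u} → u deg< 2 → coeff u 0 ≡ 0# → u ≋ 0# ∷ coeff u 1 ∷ []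
  deg<2-shape u<2 u₀≡0 =
    mk≋ λ { zero → u₀≡0 ; (suc zero) → refl ; (suc (suc i)) → vanish u<2 (suc (suc i)) (s≤s (s≤s z≤n)) }

  -- Monomials

  infix 10 t^_
  t^_ : ℕ → P
  t^ zero  = oneP
  t^ suc m = 0# ∷ t^ m

  t : P
  t = t^ 1

  δ-t^ : ∀ m → δ (t^ m) ≡ q ^ m
  δ-t^ zero    = cong suc (ℕₚ.*-zeroʳ q)
  δ-t^ (suc m) = cong (q *_) (δ-t^ m)

  coeff-t^-top : ∀ m → coeff (t^ m) m ≡ 1#
  coeff-t^-top zero    = refl
  coeff-t^-top (suc m) = coeff-t^-top m

  t^-deg< : ∀ m → t^ m deg< suc m
  t^-deg< zero    = deg<-∷ []-deg<
  t^-deg< (suc m) = deg<-∷ (t^-deg< m)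

  δ-t : δ t ≡ q
  δ-t = trans (δ-t^ 1) q^1≡q

  δ-t^<q^ : ∀ {m n} → m < n → δ (t^ m) < q ^ n
  δ-t^<q^ {m} m<n = subst (_< _) (sym (δ-t^ m)) (ℕₚ.^-monoʳ-< q 1<q m<n)

  t^-sub-monic-deg< : ∀ {v m} → v deg< suc m → coeff v m ≡ 1# → subP (t^ m) v deg< m
  t^-sub-monic-deg< {v} {m} v<1+m vm≡1 = deg<-pred (deg<-addP (t^-deg< m) (deg<-negP v<1+m)) (begin
    coeff (subP (t^ m) v) m             ≡⟨ coeff-subP (t^ m) v m ⟩
    coeff (t^ m) m +F (-F coeff v m)    ≡⟨ cong₂ (λ a b → a +F (-F b)) (coeff-t^-top m) vm≡1 ⟩
    1# +F (-F 1#)                       ≡⟨ 𝔽.-‿inverseʳ 1# ⟩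
    0#                                  ∎)
    where open ≡-Reasoning

  subP-0∷-t : ∀ f → subP (0# ∷ f) t ≋ 0# ∷ subP f oneP
  subP-0∷-t f = ∷-cong (trans (cong (0# +F_) 𝔽+.ε⁻¹≈ε) (𝔽.+-identityʳ 0#)) ≋-refl

  -- Divisibility

  infix 4 _∣_
  record _∣_ (f h : P) : Set where
    constructor divides
    field
      quotient : P
      equation : mulP quotient f ≋ h

  ∣⇒∣P : ∀ {f h} → f ∣ h → f ∣P h
  ∣⇒∣P (divides k e) = k , ≋⇒≈P e

  ∣P⇒∣ : ∀ {f h} → f ∣P h → f ∣ h
  ∣P⇒∣ (k , e) = divides k (≈P⇒≋ e)

  ∣-resp-≋ : ∀ {f f′ h h′} → f ≋ f′ → h ≋ h′ → f ∣ h → f′ ∣ h′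
  ∣-resp-≋ f≋f′ h≋h′ (divides k e) =
    divides k (≋-trans (mulP-congʳ k (≋-sym f≋f′)) (≋-trans e h≋h′))

  ∣-refl : ∀ f → f ∣ f
  ∣-refl f = divides oneP (mulP-identityˡ f)

  ∣-trans : ∀ {f g h} → f ∣ g → g ∣ h → f ∣ h
  ∣-trans {f} (divides k e) (divides l e′) =
    divides (mulP l k) (≋-trans (mulP-assoc l k f) (≋-trans (mulP-congʳ l e) e′))

  *-pres-∣ : ∀ {f g f′ g′} → f ∣ g → f′ ∣ g′ → mulP f f′ ∣ mulP g g′
  *-pres-∣ {f} {f′ = f′} (divides k e) (divides l e′) =
    divides (mulP k l) (≋-trans (ℙ*.interchange k l f f′) (ℙ.*-cong e e′))
    where module ℙ* = CommutativeSemigroupProperties ℙ.*-commutativeSemigroup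

  ∣⇒∣* : ∀ {f g} h → f ∣ g → f ∣ mulP g h
  ∣⇒∣* {f} h f∣g = ∣-resp-≋ (ℙ.*-identityʳ f) ≋-refl (*-pres-∣ f∣g (divides h (ℙ.*-identityʳ h)))

  ∣-scale : ∀ c f → f ∣ scale c f
  ∣-scale c f = divides (c ∷ []) (mulP-constˡ c f)

  0∷-pres-∣ : ∀ {f g} → f ∣ g → 0# ∷ f ∣ 0# ∷ g
  0∷-pres-∣ {f} (divides k e) = divides k (≋-trans (mulP-0∷ʳ k f) (∷-cong refl e))

  0∷-∣-* : ∀ {f g h y} → f ∣ g → h ≋ 0# ∷ y → 0# ∷ f ∣ mulP g h
  0∷-∣-* {g = g} {y = y} f∣g h≋0∷y =
    ∣-resp-≋ ≋-refl (≋-sym (≋-trans (mulP-congʳ g h≋0∷y) (mulP-0∷ʳ g y))) (0∷-pres-∣ (∣⇒∣* y f∣g))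

  quotient-bound : ∀ {f h b} k → HasDegree f b → mulP k f ≋ h → δ k < q ^ length h
  quotient-bound {f} {h} {b} k f-deg e with ≋[]⊎HasDegree k
  ... | inj₁ k≋[] = subst (_< q ^ length h) (sym (δ-≋[] k≋[])) (ℕₚ.m^n>0 q (length h))
  ... | inj₂ (a , k-deg) = deg<⇒δ< (deg<-mono a<len (proj₂ k-deg))
    where
    a+b<len : a + b < length h
    a+b<len = HasDegree⇒< (HasDegree-mulP k-deg f-deg) (deg<-resp-≋ (≋-sym e) (deg<-length h))
    a<len : suc a ≤ length h
    a<len = ℕₚ.≤-trans (s≤s (ℕₚ.m≤m+n a b)) a+b<len

  _∣?_ : ∀ f h → Dec (f ∣ h)
  f ∣? h with ≋[]⊎HasDegree f
  ... | inj₁ f≋[] with [] ≋? h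
  ...   | yes []≋h = yes (divides [] []≋h)
  ...   | no  []≉h = no λ { (divides k e) →
                       []≉h (≋-trans (≋-sym (≋-trans (mulP-congʳ k f≋[]) (mulP-zeroʳ k))) e) }
  f ∣? h | inj₂ (b , f-deg) with Finₚ.any? (λ (j : Fin (q ^ length h)) → mulP (decode (toℕ j)) f ≋? h)
  ... | yes (j , e) = yes (divides (decode (toℕ j)) e)
  ... | no  ∄j      = no λ { (divides k e) → ∄j (witness k e) }
    where
    witness : ∀ k → mulP k f ≋ h → ∃ λ (j : Fin (q ^ length h)) → mulP (decode (toℕ j)) f ≋ h
    witness k e = fromℕ< k<bound , ≋-trans (mulP-congˡ f decode-j≋k) e
      where
      k<bound = quotient-bound k f-deg e
      decode-j≋k : decode (toℕ (fromℕ< k<bound)) ≋ k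
      decode-j≋k = subst (λ n → decode n ≋ k) (sym (Finₚ.toℕ-fromℕ< k<bound)) (decode-δ k)

  const-∣-oneP : ∀ {c} → c ≢ 0# → c ∷ [] ∣ oneP
  const-∣-oneP {c} c≢0 with inverse c c≢0
  ... | c⁻¹ , cc⁻¹≡1 =
    divides (c⁻¹ ∷ []) (∷-cong (trans (𝔽.+-identityʳ _) (trans (𝔽.*-comm c⁻¹ c) cc⁻¹≡1)) ≋-refl)

  ∣oneP⇒deg<1 : ∀ {g} → g ∣ oneP → g deg< 1
  ∣oneP⇒deg<1 {g} (divides k e) with ≋[]⊎HasDegree g | ≋[]⊎HasDegree k
  ... | inj₁ g≋[]       | _ = deg<-resp-≋ (≋-sym g≋[]) []-deg<
  ... | inj₂ _          | inj₁ k≋[] with () ← trans (sym (coeff-≡ e 0)) (coeff-≡ (mulP-≋[]ˡ g k≋[]) 0)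
  ... | inj₂ (b , g-deg) | inj₂ (a , k-deg) = deg<-mono (s≤s b≤0) (proj₂ g-deg)
    where
    a+b<1 : a + b < 1
    a+b<1 = HasDegree⇒< (HasDegree-mulP k-deg g-deg) (deg<-resp-≋ (≋-sym e) (deg<-length oneP))
    b≤0 : b ≤ 0
    b≤0 = ℕₚ.≤-trans (ℕₚ.m≤n+m b a) (ℕₚ.≤-pred a+b<1)

  q≤δ⇒¬∣oneP : ∀ {g} → q ≤ δ g → ¬ g ∣ oneP
  q≤δ⇒¬∣oneP {g} q≤δg g∣1 =
    ℕₚ.<⇒≱ (subst (δ g <_) q^1≡q (deg<⇒δ< (∣oneP⇒deg<1 g∣1))) q≤δg

  -- Products and factorials

  ∏< : (ℕ → P) → ℕ → P
  ∏< φ zero    = oneP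
  ∏< φ (suc n) = mulP (∏< φ n) (φ n)

  ∏<-cong : ∀ {φ ψ} n → (∀ j → j < n → φ j ≋ ψ j) → ∏< φ n ≋ ∏< ψ n
  ∏<-cong zero    _    = ≋-refl
  ∏<-cong (suc n) φ≋ψ = ℙ.*-cong (∏<-cong n (λ j j<n → φ≋ψ j (ℕₚ.m<n⇒m<1+n j<n))) (φ≋ψ n ℕₚ.≤-refl)

  ∏<-+ : ∀ φ m n → ∏< φ (m + n) ≋ mulP (∏< φ m) (∏< (λ j → φ (m + j)) n)
  ∏<-+ φ m zero    rewrite ℕₚ.+-identityʳ m = ≋-sym (ℙ.*-identityʳ _)
  ∏<-+ φ m (suc n) rewrite ℕₚ.+-suc m n =
    ≋-trans (ℙ.*-cong (∏<-+ φ m n) ≋-refl) (ℙ.*-assoc (∏< φ m) _ _)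

  ∏<-* : ∀ φ m N → ∏< φ (m * N) ≋ ∏< (λ k → ∏< (λ j → φ (m * k + j)) m) N
  ∏<-* φ m zero    rewrite ℕₚ.*-zeroʳ m = ≋-refl
  ∏<-* φ m (suc N) rewrite ℕₚ.*-suc m N | ℕₚ.+-comm m (m * N) =
    ≋-trans (∏<-+ φ (m * N) m) (ℙ.*-cong (∏<-* φ m N) ≋-refl)

  ∏<-factor-∣ : ∀ φ {j n} → j < n → φ j ∣ ∏< φ n
  ∏<-factor-∣ φ {j} {suc n} j<1+n with ℕₚ.m<1+n⇒m<n∨m≡n j<1+n
  ... | inj₁ j<n  = ∣⇒∣* (φ n) (∏<-factor-∣ φ j<n)
  ... | inj₂ refl = divides (∏< φ n) ≋-refl

  ∏<-two-factors-∣ : ∀ φ {i j n} → i ≢ j → i < n → j < n → mulP (φ i) (φ j) ∣ ∏< φ n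
  ∏<-two-factors-∣ φ {i} {j} {suc n} i≢j i<1+n j<1+n
    with ℕₚ.m<1+n⇒m<n∨m≡n i<1+n | ℕₚ.m<1+n⇒m<n∨m≡n j<1+n
  ... | inj₁ i<n  | inj₁ j<n  = ∣⇒∣* (φ n) (∏<-two-factors-∣ φ i≢j i<n j<n)
  ... | inj₁ i<n  | inj₂ refl = *-pres-∣ (∏<-factor-∣ φ i<n) (∣-refl (φ j))
  ... | inj₂ refl | inj₁ j<n  =
    ∣-resp-≋ (ℙ.*-comm (φ j) (φ i)) ≋-refl (*-pres-∣ (∏<-factor-∣ φ j<n) (∣-refl (φ i)))
  ... | inj₂ refl | inj₂ refl = ⊥-elim (i≢j refl)

  ∏<-∣oneP : ∀ φ n → (∀ j → j < n → φ j ∣ oneP) → ∏< φ n ∣ oneP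
  ∏<-∣oneP φ zero    _     = ∣-refl oneP
  ∏<-∣oneP φ (suc n) units = ∣-resp-≋ ≋-refl (ℙ.*-identityʳ oneP)
    (*-pres-∣ (∏<-∣oneP φ n (λ j j<n → units j (ℕₚ.m<n⇒m<1+n j<n))) (units n ℕₚ.≤-refl))

  ∏<≋sum : ∀ φ n → ∏< φ n ≋ ℙΣ.sum (λ (i : Fin n) → φ (toℕ i))
  ∏<≋sum φ zero    = ≋-refl
  ∏<≋sum φ (suc n) = begin
    mulP (∏< φ n) (φ n)                                          ≈⟨ ℙ.*-cong (∏<≋sum φ n) ≋-refl ⟩
    mulP (ℙΣ.sum {n} (φ ∘ toℕ)) (φ n)
      ≡⟨ cong₂ mulP (ℙΣ.sum-cong-≗ {n} (λ i → cong φ (Finₚ.toℕ-inject₁ i))) (cong φ (Finₚ.toℕ-fromℕ n)) ⟨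
    mulP (ℙΣ.sum {n} (init (φ ∘ toℕ))) (φ (toℕ (Fin.fromℕ n)))
                                                                 ≈⟨ ℙΣ.sum-init-last {n} (φ ∘ toℕ) ⟨
    ℙΣ.sum {suc n} (φ ∘ toℕ)                                      ∎
    where open ≋-Reasoning

  sum-translate : ∀ (φ : K → P) c → ℙΣ.sum (λ i → φ (c +F (-F i))) ≋ ℙΣ.sum (λ i → φ (-F i))
  sum-translate φ c =
    ≋-trans (ℙΣ.sum-permute (λ i → φ (c +F (-F i))) (permutation (_+F c) (_+F (-F c)) cancel cancel′))
            (≡⇒≋ (ℙΣ.sum-cong-≗ (λ i → cong φ (x-[y+x]≡-y c i))))
    where
    cancel : ∀ y → (y +F (-F c)) +F c ≡ y
    cancel y = trans (𝔽.+-assoc y _ c) (trans (cong (y +F_) (𝔽.-‿inverseˡ c)) (𝔽.+-identityʳ y))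
    cancel′ : ∀ y → (y +F c) +F (-F c) ≡ y
    cancel′ y = trans (𝔽.+-assoc y c _) (trans (cong (y +F_) (𝔽.-‿inverseʳ c)) (𝔽.+-identityʳ y))

  !-as-∏< : ∀ h → h ! ≡ ∏< (subP h ∘ decode) (δ h)
  !-as-∏< h = prodBelow≡∏< (δ h)
    where
    prodBelow≡∏< : ∀ n → prodBelow h n ≡ ∏< (subP h ∘ decode) n
    prodBelow≡∏< zero    = refl
    prodBelow≡∏< (suc n) = cong (λ p → mulP p (subP h (decode n))) (prodBelow≡∏< n)

  subP-decode-δ : ∀ h a → subP h (decode (δ a)) ≋ subP h a
  subP-decode-δ h a = addP-cong ≋-refl (negP-cong (decode-δ a))

  !-cong : ∀ {h h′} → h ≋ h′ → h ! ≋ h′ !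
  !-cong {h} {h′} h≋h′ rewrite !-as-∏< h | !-as-∏< h′ | δ-cong h≋h′ =
    ∏<-cong (δ h′) (λ j _ → addP-cong h≋h′ ≋-refl)

  subP-∣-! : ∀ h {a} → δ a < δ h → subP h a ∣ h !
  subP-∣-! h {a} δa<δh = ∣-resp-≋ (subP-decode-δ h a) (≡⇒≋ (sym (!-as-∏< h)))
    (∏<-factor-∣ (subP h ∘ decode) δa<δh)

  subP-subP-∣-! : ∀ h {a b} → δ a ≢ δ b → δ a < δ h → δ b < δ h → mulP (subP h a) (subP h b) ∣ h !
  subP-subP-∣-! h {a} {b} δa≢δb δa<δh δb<δh =
    ∣-resp-≋ (ℙ.*-cong (subP-decode-δ h a) (subP-decode-δ h b)) (≡⇒≋ (sym (!-as-∏< h)))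
      (∏<-two-factors-∣ (subP h ∘ decode) δa≢δb δa<δh δb<δh)

  ∣-!-self : ∀ h → δ h ≢ 0 → h ∣ h !
  ∣-!-self h δh≢0 = ∣-resp-≋ (addP-identityʳ h) ≋-refl (subP-∣-! h (ℕₚ.n≢0⇒n>0 δh≢0))

  ∣-!-decode-δ : ∀ {f} h → f ∣ h ! → f ∣ decode (δ h) !
  ∣-!-decode-δ h = ∣-resp-≋ ≋-refl (!-cong (≋-sym (decode-δ h)))

  subP-∷-digit : ∀ c g k {j} (j<q : j < q) →
                 subP (c ∷ g) (decode (q * k + j)) ≋ (c +F (-F fromℕ< j<q)) ∷ subP g (decode k)
  subP-∷-digit c g k j<q = addP-cong ≋-refl (negP-cong (decode-digit k j<q))

  ∏<-block-independent : ∀ c c′ g k →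
    ∏< (λ j → subP (c ∷ g) (decode (q * k + j))) q ≋ ∏< (λ j → subP (c′ ∷ g) (decode (q * k + j))) q
  ∏<-block-independent c c′ g k = ≋-trans (block≋ c) (≋-sym (block≋ c′))
    where
    block≋ : ∀ c → ∏< (λ j → subP (c ∷ g) (decode (q * k + j))) q
                   ≋ ℙΣ.sum (λ i → (-F i) ∷ subP g (decode k))
    block≋ c = ≋-trans (∏<≋sum _ q)
                       (≋-trans (ℙΣ.sum-cong-≋ digit) (sum-translate (_∷ subP g (decode k)) c))
      where
      digit : ∀ i → subP (c ∷ g) (decode (q * k + toℕ i)) ≋ (c +F (-F i)) ∷ subP g (decode k)
      digit i = ≋-trans (subP-∷-digit c g k (Finₚ.toℕ<n i))
                        (∷-cong (cong (λ a → c +F (-F a)) (Finₚ.fromℕ<-toℕ i (Finₚ.toℕ<n i))) ≋-refl)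

  ∷!∣0∷! : ∀ c g → (c ∷ g) ! ∣ (0# ∷ g) !
  ∷!∣0∷! c g = ∣-resp-≋ (≋-sym factorisation) (ℙ.*-identityʳ ((0# ∷ g) !))
                 (*-pres-∣ (∣-refl ((0# ∷ g) !)) (∏<-∣oneP _ (toℕ c) partial-block-unit))
    where
    N = δ g
    φ : K → ℕ → P
    φ c′ = subP (c′ ∷ g) ∘ decode

    full-blocks : ∏< (φ c) (q * N) ≋ (0# ∷ g) !
    full-blocks = begin
      ∏< (φ c) (q * N)                              ≈⟨ ∏<-* (φ c) q N ⟩
      ∏< (λ k → ∏< (λ j → φ c (q * k + j)) q) N     ≈⟨ ∏<-cong N (λ k _ → ∏<-block-independent c 0# g k) ⟩
      ∏< (λ k → ∏< (λ j → φ 0# (q * k + j)) q) N    ≈⟨ ∏<-* (φ 0#) q N ⟨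
      ∏< (φ 0#) (q * N)                             ≡⟨ !-as-∏< (0# ∷ g) ⟨
      (0# ∷ g) !                                    ∎
      where open ≋-Reasoning

    factorisation : (c ∷ g) ! ≋ mulP ((0# ∷ g) !) (∏< (λ j → φ c (q * N + j)) (toℕ c))
    factorisation = begin
      (c ∷ g) !                  ≡⟨ trans (!-as-∏< (c ∷ g)) (cong (∏< (φ c)) (ℕₚ.+-comm (toℕ c) (q * N))) ⟩
      ∏< (φ c) (q * N + toℕ c)   ≈⟨ ∏<-+ (φ c) (q * N) (toℕ c) ⟩
      mulP (∏< (φ c) (q * N)) _  ≈⟨ ℙ.*-cong full-blocks ≋-refl ⟩
      mulP ((0# ∷ g) !) _        ∎
      where open ≋-Reasoning

    partial-block-unit : ∀ j → j < toℕ c → φ c (q * N + j) ∣ oneP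
    partial-block-unit j j<c = ∣-resp-≋ (≋-sym constant) ≋-refl (const-∣-oneP (x-y≢0 c≢aⱼ))
      where
      j<q = ℕₚ.<-trans j<c (Finₚ.toℕ<n c)
      constant : φ c (q * N + j) ≋ (c +F (-F fromℕ< j<q)) ∷ []
      constant = ≋-trans (subP-∷-digit c g N j<q)
                         (∷-cong refl (≋-trans (subP-decode-δ g g) (addP-inverseʳ g)))
      c≢aⱼ : c ≢ fromℕ< j<q
      c≢aⱼ c≡aⱼ = ℕₚ.<-irrefl (trans (sym (Finₚ.toℕ-fromℕ< j<q)) (cong toℕ (sym c≡aⱼ))) j<c

  δ<q⇒!∣oneP : ∀ h → δ h < q → h ! ∣ oneP
  δ<q⇒!∣oneP h δh<q = ∣-resp-≋ (!-cong (≋-sym h≋c)) (!-cong (0∷≋[] ≋-refl)) (∷!∣0∷! c [])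
    where
    c = fromℕ< δh<q
    h≋c : h ≋ c ∷ []
    h≋c = δ-injective h (c ∷ []) (begin
      δ h               ≡⟨ Finₚ.toℕ-fromℕ< δh<q ⟨
      toℕ c             ≡⟨ ℕₚ.+-identityʳ (toℕ c) ⟨
      toℕ c + 0         ≡⟨ cong (toℕ c +_) (ℕₚ.*-zeroʳ q) ⟨
      toℕ c + q * 0     ∎)
      where open ≡-Reasoning

  -- The Smarandache function

  S-intro : ∀ {f g} → δ f ≢ 0 → f ∣ g ! → (∀ h → δ h < δ g → ¬ f ∣ h !) → IsS f g
  S-intro {f} {g} δf≢0 f∣g! below =
    inj₂ (δf≢0 , ∣⇒∣P {f} {g !} f∣g! , λ h δh<δg f∣h! → below h δh<δg (∣P⇒∣ {f} {h !} f∣h!))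

  S-∣ : ∀ {f g} → IsS f g → δ g ≢ 0 → f ∣ g !
  S-∣         (inj₁ (_ , δg≡0))   δg≢0 = ⊥-elim (δg≢0 δg≡0)
  S-∣ {f} {g} (inj₂ (_ , f∣ , _)) _    = ∣P⇒∣ {f} {g !} f∣

  S-minimal : ∀ {f g} h → IsS f g → f ∣ h ! → δ g ≤ δ h
  S-minimal     h (inj₁ (_ , δg≡0))    _    rewrite δg≡0 = z≤n
  S-minimal {f} h (inj₂ (_ , _ , min)) f∣h! = ℕₚ.≮⇒≥ (λ δh<δg → min h δh<δg (∣⇒∣P {f} {h !} f∣h!))

  S-exists : ∀ f → ∃ (IsS f)
  S-exists f with δ f ℕₚ.≟ 0
  ... | yes δf≡0 = [] , inj₁ (δf≡0 , refl)
  ... | no  δf≢0 with least (λ n → f ∣? (decode n !)) {δ f} (∣-!-decode-δ f (∣-!-self f δf≢0))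
  ...   | n , f∣ , below = decode n , S-intro {f} {decode n} δf≢0 f∣ λ h δh<δ f∣h! →
            below (δ h) (subst (δ h <_) (δ-decode n) δh<δ) (∣-!-decode-δ h f∣h!)

  S-≤ : ∀ {f g} → IsS f g → δ g ≤ δ f
  S-≤         (inj₁ (_ , δg≡0))     rewrite δg≡0 = z≤n
  S-≤ {f} {g} s@(inj₂ (δf≢0 , _)) = S-minimal {f} {g} f s (∣-!-self f δf≢0)

  S-fixed-of-≋ : ∀ {g g′} → IsS g g′ → g ≋ g′ → IsS g′ g′
  S-fixed-of-≋ (inj₁ (_ , δg′≡0)) _ = inj₁ (δg′≡0 , δg′≡0)
  S-fixed-of-≋ {g} {g′} s@(inj₂ (δg≢0 , _)) g≋g′ =
    S-intro {g′} {g′} δg′≢0 (∣-resp-≋ g≋g′ ≋-refl (S-∣ {g} {g′} s δg′≢0)) λ h δh<δg′ g′∣h! →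
      ℕₚ.<⇒≱ δh<δg′ (S-minimal {g} {g′} h s (∣-resp-≋ (≋-sym g≋g′) ≋-refl g′∣h!))
    where
    δg′≢0 : δ g′ ≢ 0
    δg′≢0 = δg≢0 ∘ trans (δ-cong g≋g′)

  S-constant-term : ∀ {f g} → IsS f g → δ g ≢ 0 → coeff g 0 ≡ 0#
  S-constant-term {g = []}        _ _    = refl
  S-constant-term {f} {g = c ∷ g} s δg≢0 with c Fin.≟ 0#
  ... | yes c≡0 = c≡0
  ... | no  c≢0 = ⊥-elim (ℕₚ.<⇒≱ smaller (S-minimal {f} {c ∷ g} (0# ∷ g) s f∣[0∷g]!))
    where
    smaller : δ (0# ∷ g) < δ (c ∷ g)
    smaller = ℕₚ.+-monoˡ-< (q * δ g) (ℕₚ.n≢0⇒n>0 (c≢0 ∘ Finₚ.toℕ-injective))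
    f∣[0∷g]! : f ∣ (0# ∷ g) !
    f∣[0∷g]! = ∣-trans (S-∣ {f} {c ∷ g} s δg≢0) (∷!∣0∷! c g)

  S-q≤δ : ∀ {f g} → IsS f g → δ g ≢ 0 → q ≤ δ g
  S-q≤δ {f} {g} s δg≢0 = ℕₚ.≮⇒≥ λ δg<q →
    δg≢0 (δ-≋[] (deg<0⇒≋[] (deg<-pred (g<1 δg<q) (S-constant-term {f} {g} s δg≢0))))
    where
    g<1 : δ g < q → g deg< 1
    g<1 δg<q = δ<⇒deg< g 1 (subst (δ g <_) (sym q^1≡q) δg<q)

  S-fixed-at-q : ∀ {g} → δ g ≡ q → IsS g g
  S-fixed-at-q {g} δg≡q = S-intro {g} {g} δg≢0 (∣-!-self g δg≢0) λ h δh<q g∣h! →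
    q≤δ⇒¬∣oneP (ℕₚ.≤-reflexive (sym δg≡q)) (∣-trans g∣h! (δ<q⇒!∣oneP h (subst (δ h <_) δg≡q δh<q)))
    where
    δg≢0 : δ g ≢ 0
    δg≢0 = q≢0 ∘ trans (sym δg≡q)

  S-fixed-of-δ≤q : ∀ {f g} → IsS f g → δ g ≤ q → IsS g g
  S-fixed-of-δ≤q {f} {g} s δg≤q with δ g ℕₚ.≟ 0
  ... | yes δg≡0 = inj₁ (δg≡0 , δg≡0)
  ... | no  δg≢0 = S-fixed-at-q (ℕₚ.≤-antisym δg≤q (S-q≤δ {f} {g} s δg≢0))

  S-image-shape : ∀ {f g} d → IsS f g → q ^ suc d ≤ δ g → δ g < q ^ suc (suc d) →
                  ∃ λ u → g ≋ 0# ∷ u × HasDegree u d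
  S-image-shape {g = []}    d _ q^[1+d]≤0 _ = ⊥-elim (ℕₚ.<⇒≱ (ℕₚ.m^n>0 q (suc d)) q^[1+d]≤0)
  S-image-shape {f} {g = c ∷ u} d s q^[1+d]≤δg δg<q^[2+d] =
    u , ∷-cong (S-constant-term {f} {c ∷ u} s δg≢0) ≋-refl , top≢0 , deg<-tail g<2+d
    where
    δg≢0 : δ (c ∷ u) ≢ 0
    δg≢0 δg≡0 = ℕₚ.<⇒≱ (ℕₚ.m^n>0 q (suc d)) (subst (q ^ suc d ≤_) δg≡0 q^[1+d]≤δg)
    g<2+d : c ∷ u deg< suc (suc d)
    g<2+d = δ<⇒deg< (c ∷ u) (suc (suc d)) δg<q^[2+d]
    top≢0 : coeff u d ≢ 0#
    top≢0 ud≡0 = ℕₚ.<⇒≱ (deg<⇒δ< (deg<-pred g<2+d ud≡0)) q^[1+d]≤δg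

  -- Descent of the degree

  -- With v the monic multiple of u, w = t^(m+1) − v lies below t^(m+1), so (t^(m+1))! has the
  -- distinct factors t^(m+1) − w = v and t^(m+1) − b = t·y, where b = 0, or b = t if w = 0.
  0∷u-∣-t^! : ∀ {u m} → HasDegree u (suc m) → 1 ≤ m ⊎ coeff u 0 ≢ 0# → 0# ∷ u ∣ (t^ suc m) !
  0∷u-∣-t^! {u} {m} (top≢0 , u<2+m) 1≤m⊎u₀≢0 = conclude (second-factor 1≤m⊎u₀≢0)
    where
    h = t^ suc m
    c = coeff u (suc m)
    c⁻¹ = proj₁ (inverse c top≢0)
    cc⁻¹≡1 = proj₂ (inverse c top≢0)
    v = scale c⁻¹ u
    w = subP h v

    v-monic : coeff v (suc m) ≡ 1#
    v-monic = trans (coeff-scale c⁻¹ u (suc m)) (trans (𝔽.*-comm c⁻¹ c) cc⁻¹≡1)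

    c⁻¹≢0 : c⁻¹ ≢ 0#
    c⁻¹≢0 c⁻¹≡0 with () ← trans (sym cc⁻¹≡1) (trans (cong (c *F_) c⁻¹≡0) (𝔽.zeroʳ c))

    δw<δh : δ w < δ h
    δw<δh = subst (δ w <_) (sym (δ-t^ (suc m)))
              (deg<⇒δ< (t^-sub-monic-deg< (deg<-scale c⁻¹ u<2+m) v-monic))

    u₀≡0 : w ≋ [] → coeff u 0 ≡ 0#
    u₀≡0 w≋[] = x*y≡0⇒y≡0 c⁻¹≢0 (begin
      c⁻¹ *F coeff u 0      ≡⟨ coeff-scale c⁻¹ u 0 ⟨
      coeff v 0             ≡⟨ coeff-≡ (subP-subP h v) 0 ⟨
      coeff (subP h w) 0    ≡⟨ coeff-≡ (addP-cong (≋-refl {h}) (negP-cong w≋[])) 0 ⟩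
      coeff (addP h []) 0   ≡⟨ coeff-≡ (addP-identityʳ h) 0 ⟩
      0#                    ∎)
      where open ≡-Reasoning

    SecondFactor : Set
    SecondFactor = ∃ λ b → δ b ≢ δ w × δ b < δ h × ∃ λ y → subP h b ≋ 0# ∷ y

    second-factor : 1 ≤ m ⊎ coeff u 0 ≢ 0# → SecondFactor
    second-factor 1≤m⊎u₀≢0 with δ w ℕₚ.≟ 0 | 1≤m⊎u₀≢0
    ... | no δw≢0  | _          = [] , δw≢0 ∘ sym , ℕₚ.≤-<-trans z≤n δw<δh , t^ m , addP-identityʳ h
    ... | yes δw≡0 | inj₂ u₀≢0 = ⊥-elim (u₀≢0 (u₀≡0 (δ≡0⇒≋[] w δw≡0)))
    ... | yes δw≡0 | inj₁ 1≤m  = t , δt≢δw , δt<δh , subP (t^ m) oneP , subP-0∷-t (t^ m)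
      where
      δt≢δw : δ t ≢ δ w
      δt≢δw δt≡δw = q≢0 (trans (sym δ-t) (trans δt≡δw δw≡0))
      δt<δh : δ t < δ h
      δt<δh = subst (δ t <_) (sym (δ-t^ (suc m))) (δ-t^<q^ (s≤s 1≤m))

    conclude : SecondFactor → 0# ∷ u ∣ h !
    conclude (b , δb≢δw , δb<δh , y , hb≋0∷y) =
      ∣-trans (∣-resp-≋ ≋-refl (ℙ.*-cong (≋-sym (subP-subP h v)) ≋-refl) (0∷-∣-* (∣-scale c⁻¹ u) hb≋0∷y))
              (subP-subP-∣-! h {w} {b} (δb≢δw ∘ sym) δw<δh δb<δh)

  δ-0∷c : ∀ c → δ (0# ∷ c ∷ []) ≡ q * toℕ c
  δ-0∷c c = cong (q *_) (trans (cong (toℕ c +_) (ℕₚ.*-zeroʳ q)) (ℕₚ.+-identityʳ (toℕ c)))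

  δ-0∷c<q² : ∀ c → δ (0# ∷ c ∷ []) < q ^ 2
  δ-0∷c<q² c = subst₂ _<_ (sym (δ-0∷c c)) (cong (q *_) (sym q^1≡q)) (ℕₚ.*-monoʳ-< q (Finₚ.toℕ<n c))

  0∷0∷c-∣-0∷c! : ∀ {c} → c ≢ 0# → c ≢ 1# → 0# ∷ 0# ∷ c ∷ [] ∣ (0# ∷ c ∷ []) !
  0∷0∷c-∣-0∷c! {c} c≢0 c≢1 =
    ∣-trans (0∷-∣-* h∣h-0 (subP-0∷-t (c ∷ []))) (subP-subP-∣-! h {[]} {t} 0≢δt 0<δh δt<δh)
    where
    h = 0# ∷ c ∷ []
    h∣h-0 : h ∣ subP h []
    h∣h-0 = ∣-resp-≋ ≋-refl (≋-sym (addP-identityʳ h)) (∣-refl h)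
    0≢δt : 0 ≢ δ t
    0≢δt 0≡δt = q≢0 (sym (trans 0≡δt δ-t))
    δt<δh : δ t < δ h
    δt<δh = subst₂ _<_ (trans (ℕₚ.*-identityʳ q) (sym δ-t)) (sym (δ-0∷c c))
                       (ℕₚ.*-monoʳ-< q (2≤toℕ c≢0 c≢1))
    0<δh : 0 < δ h
    0<δh = ℕₚ.≤-<-trans z≤n δt<δh

  ≋t^⊎∣-small-! : ∀ {u m} → HasDegree u (suc m) →
    0# ∷ u ≋ t^ suc (suc m) ⊎ ∃ λ h → δ h < q ^ suc (suc m) × 0# ∷ u ∣ h !
  ≋t^⊎∣-small-! {u} {suc m} u-deg =
    inj₂ (t^ suc (suc m) , δt^<q^ , 0∷u-∣-t^! u-deg (inj₁ (s≤s z≤n)))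
    where
    δt^<q^ = δ-t^<q^ {suc (suc m)} ℕₚ.≤-refl
  ≋t^⊎∣-small-! {u} {zero} u-deg@(u₁≢0 , u<2) with coeff u 0 Fin.≟ 0#
  ... | no u₀≢0 = inj₂ (t , δ-t^<q^ {1} ℕₚ.≤-refl
                       , 0∷u-∣-t^! u-deg (inj₂ u₀≢0))
  ... | yes u₀≡0 with coeff u 1 Fin.≟ 1#
  ...   | yes u₁≡1 = inj₁ (∷-cong refl (≋-trans u≋0∷u₁ (∷-cong refl (∷-cong u₁≡1 ≋-refl))))
    where u≋0∷u₁ = deg<2-shape u<2 u₀≡0
  ...   | no  u₁≢1 = inj₂ (0# ∷ coeff u 1 ∷ [] , δ-0∷c<q² (coeff u 1) ,
                           ∣-resp-≋ (∷-cong refl (≋-sym u≋0∷u₁)) ≋-refl (0∷0∷c-∣-0∷c! u₁≢0 u₁≢1))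
    where u≋0∷u₁ = deg<2-shape u<2 u₀≡0

  S-stall⇒fixed : ∀ {g g′ u} d → IsS g g′ → g ≋ 0# ∷ u → HasDegree u d → q ^ suc d ≤ δ g′ → IsS g′ g′
  S-stall⇒fixed {g} {g′} {u} zero s′ g≋0∷u (u₀≢0 , u<1) _ =
    S-fixed-of-δ≤q {g} {g′} s′ (ℕₚ.≤-trans (S-minimal {g} {g′} t s′ g∣t!) (ℕₚ.≤-reflexive δ-t))
    where
    g∣t : g ∣ t
    g∣t = ∣-resp-≋ (≋-sym g≋0∷u) ≋-refl
            (0∷-pres-∣ (∣-resp-≋ (≋-sym (deg<1-shape u<1)) ≋-refl (const-∣-oneP u₀≢0)))
    g∣t! : g ∣ t !
    g∣t! = ∣-trans g∣t (∣-!-self t (q≢0 ∘ trans (sym δ-t)))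
  S-stall⇒fixed {g} {g′} (suc m) s′ g≋0∷u u-deg q^[2+m]≤δg′ with ≋t^⊎∣-small-! u-deg
  ... | inj₁ 0∷u≋t^ = S-fixed-of-≋ {g} {g′} s′ (δ-injective g g′ (ℕₚ.≤-antisym δg≤δg′ (S-≤ {g} {g′} s′)))
    where
    δg≤δg′ : δ g ≤ δ g′
    δg≤δg′ = subst (_≤ δ g′) (sym (trans (δ-cong (≋-trans g≋0∷u 0∷u≋t^)) (δ-t^ (suc (suc m)))))
                   q^[2+m]≤δg′
  ... | inj₂ (h , δh<q^[2+m] , 0∷u∣h!) = ⊥-elim (ℕₚ.<⇒≱ (ℕₚ.≤-<-trans δg′≤δh δh<q^[2+m]) q^[2+m]≤δg′)
    where
    δg′≤δh : δ g′ ≤ δ h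
    δg′≤δh = S-minimal {g} {g′} h s′ (∣-resp-≋ (≋-sym g≋0∷u) ≋-refl 0∷u∣h!)

  S-descends : ∀ {f g g′} d → IsS f g → IsS g g′ → δ g < q ^ suc (suc d) → IsS g′ g′ ⊎ δ g′ < q ^ suc d
  S-descends {f} {g} {g′} d s s′ δg<q^[2+d] with δ g′ ℕₚ.<? q ^ suc d
  ... | yes δg′<q^[1+d] = inj₂ δg′<q^[1+d]
  ... | no  δg′≮q^[1+d]
      with S-image-shape {f} {g} d s (ℕₚ.≤-trans (ℕₚ.≮⇒≥ δg′≮q^[1+d]) (S-≤ {g} {g′} s′)) δg<q^[2+d]
  ...   | u , g≋0∷u , u-deg = inj₁ (S-stall⇒fixed d s′ g≋0∷u u-deg (ℕₚ.≮⇒≥ δg′≮q^[1+d]))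

  IterS-∷ : ∀ {f g h n} → IsS f g → IterS g n h → IterS f (suc n) h
  IterS-∷ s iter-zero          = iter-suc iter-zero s
  IterS-∷ s (iter-suc g↦ⁿh s′) = iter-suc (IterS-∷ s g↦ⁿh) s′

  S-reaches-fixed-point : ∀ k {f g} → IsS f g → δ g < q ^ suc k →
                          ∃ λ n → n ≤ k × ∃ λ h → IterS g n h × IsS h h
  S-reaches-fixed-point zero {f} {g} s δg<q^1 =
    0 , z≤n , g , iter-zero , S-fixed-of-δ≤q {f} {g} s (ℕₚ.<⇒≤ (subst (δ g <_) q^1≡q δg<q^1))
  S-reaches-fixed-point (suc k) {f} {g} s δg<q^[2+k] with S-exists g
  ... | g′ , s′ with S-descends {f} {g} {g′} k s s′ δg<q^[2+k]
  ...   | inj₁ g′-fixed = 1 , s≤s z≤n , g′ , iter-suc iter-zero s′ , g′-fixed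
  ...   | inj₂ δg′<q^[1+k] with S-reaches-fixed-point k {g} {g′} s′ δg′<q^[1+k]
  ...     | n , n≤k , h , g′↦ⁿh , h-fixed = suc n , s≤s n≤k , h , IterS-∷ {g} {g′} s′ g′↦ⁿh , h-fixed

proposition3p12 : ∀ {r : ℕ} (F : FiniteField r) → let open Poly F in
    ∀ (f : P) → 1 ≤ deg f →
      ∃ λ n → 1 ≤ n × n ≤ 1 + deg f × ∃ λ g → IterS f n g × IsS g g
proposition3p12 F f _ with S-exists F f
... | g , f↦g
    with S-reaches-fixed-point F (deg f) {f} {g} f↦g (ℕₚ.≤-<-trans (S-≤ F {f} {g} f↦g) (δ<q^[1+deg] F f))
  where open Poly F
... | n , n≤deg , h , g↦ⁿh , h-fixed =
  suc n , s≤s z≤n , s≤s n≤deg , h , IterS-∷ F {f} {g} f↦g g↦ⁿh , h-fixed
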